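{- Let $P:\mathcal{C}^{op}\to\mathbf{InfSL}$ be a variational doctrine. An arrow $m:X\to A$ of $\mathcal{C}$ is a monomorphism if and only if it is $P$-injective, i.e. $P_{m\times m}(\delta_A)=\delta_X$.
   Context: A primary doctrine is a functor $P:\mathcal{C}^{op}\to\mathbf{InfSL}$, $\mathcal{C}$ with finite products, $\mathbf{InfSL}$ the category of inf-semilattices and meet-preserving maps; $P_f=P(f)$, $\top_A$ the top of $P(A)$. $P$ is elementary if for each $A$ there is $\delta_A\in P(A\times A)$ such that for every $X$ the map $\alpha\mapsto P_{\langle pr_1,pr_2\rangle}(\alpha)\wedge P_{\langle pr_2,pr_3\rangle}(\delta_A)$, $P(X\times A)\to P(X\times A\times A)$, is left adjoint to $P_{\langle pr_1,pr_2,pr_2\rangle}$. $P$ is variational if it is elementary, has comprehensive diagonals (for $f,g:X\to A$: $f=g$ iff $\top_X=P_{\langle f,g\rangle}(\delta_A)$) and full weak comprehension (for each $\alpha\in P(A)$ there is $\{\alpha\}:X\to A$ with $\top_X=P_{\{\alpha\}}(\alpha)$ through which every $f:Y\to A$ with $\top_Y\le P_f(\alpha)$ factors, not necessarily uniquely, and with $\alpha\le\beta$ iff $\top_X\le P_{\{\alpha\}}(\beta)$). -}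

module Defs where

open import Level using (Level; _⊔_; suc)
open import Relation.Binary.PropositionalEquality using (_≡_)
open import Relation.Binary.Lattice.Bundles using (BoundedMeetSemilattice)
open import Data.Product using (Σ; _×_; _,_)
open import Function using (_⇔_)

record Category (o h : Level) : Set (suc (o ⊔ h)) where
  infixr 9 _∘_
  field
    Obj  : Set o
    Hom  : Obj → Obj → Set h
    id   : ∀ {A} → Hom A A
    _∘_  : ∀ {A B C} → Hom B C → Hom A B → Hom A C
    identityˡ : ∀ {A B} {f : Hom A B} → id ∘ f ≡ f
    identityʳ : ∀ {A B} {f : Hom A B} → f ∘ id ≡ f
    assoc     : ∀ {A B C D} {f : Hom A B} {g : Hom B C} {h : Hom C D} →
                (h ∘ g) ∘ f ≡ h ∘ (g ∘ f)

record CartesianCategory (o h : Level) : Set (suc (o ⊔ h)) where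
  field
    category : Category o h
  open Category category public
  infixr 7 _⊗_
  field
    𝟙      : Obj
    !      : ∀ {A} → Hom A 𝟙
    !-unique : ∀ {A} (f : Hom A 𝟙) → f ≡ !
    _⊗_    : Obj → Obj → Obj
    π₁     : ∀ {A B} → Hom (A ⊗ B) A
    π₂     : ∀ {A B} → Hom (A ⊗ B) B
    ⟨_,_⟩  : ∀ {X A B} → Hom X A → Hom X B → Hom X (A ⊗ B)
    π₁-β   : ∀ {X A B} {f : Hom X A} {g : Hom X B} → π₁ ∘ ⟨ f , g ⟩ ≡ f
    π₂-β   : ∀ {X A B} {f : Hom X A} {g : Hom X B} → π₂ ∘ ⟨ f , g ⟩ ≡ g
    ⟨⟩-unique : ∀ {X A B} {f : Hom X A} {g : Hom X B} (k : Hom X (A ⊗ B)) →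
                π₁ ∘ k ≡ f → π₂ ∘ k ≡ g → k ≡ ⟨ f , g ⟩

  _×₁_ : ∀ {X Y A B} → Hom X A → Hom Y B → Hom (X ⊗ Y) (A ⊗ B)
  f ×₁ g = ⟨ f ∘ π₁ , g ∘ π₂ ⟩

  IsMono : ∀ {X A} → Hom X A → Set (o ⊔ h)
  IsMono {X} m = ∀ {Y} (f g : Hom Y X) → m ∘ f ≡ m ∘ g → f ≡ g

record PrimaryDoctrine {o h : Level} (C : CartesianCategory o h) (c ℓ₁ ℓ₂ : Level)
       : Set (suc (o ⊔ h ⊔ c ⊔ ℓ₁ ⊔ ℓ₂)) where
  open CartesianCategory C
  field
    P₀ : Obj → BoundedMeetSemilattice c ℓ₁ ℓ₂
  module P (A : Obj) = BoundedMeetSemilattice (P₀ A)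
  field
    P₁ : ∀ {A B} → Hom A B → P.Carrier B → P.Carrier A
    P₁-cong : ∀ {A B} (f : Hom A B) {α β : P.Carrier B} →
              P._≈_ B α β → P._≈_ A (P₁ f α) (P₁ f β)
    P₁-∧ : ∀ {A B} (f : Hom A B) (α β : P.Carrier B) →
           P._≈_ A (P₁ f (P._∧_ B α β)) (P._∧_ A (P₁ f α) (P₁ f β))
    P₁-⊤ : ∀ {A B} (f : Hom A B) → P._≈_ A (P₁ f (P.⊤ B)) (P.⊤ A)
    P-id : ∀ {A} (α : P.Carrier A) → P._≈_ A (P₁ id α) α
    P-∘  : ∀ {A B D} (f : Hom A B) (g : Hom B D) (α : P.Carrier D) →
           P._≈_ A (P₁ (g ∘ f) α) (P₁ f (P₁ g α))

module _ {o h c ℓ₁ ℓ₂ : Level} {C : CartesianCategory o h}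
         (D : PrimaryDoctrine C c ℓ₁ ℓ₂) where
  open CartesianCategory C
  open PrimaryDoctrine D

  -- For X × A × A = (X × A) × A:
  --   ⟨pr1,pr2⟩     : X×A×A → X×A  is  π₁
  --   ⟨pr2,pr3⟩     : X×A×A → A×A  is  ⟨ π₂ ∘ π₁ , π₂ ⟩
  --   ⟨pr1,pr2,pr2⟩ : X×A → X×A×A  is  ⟨ id , π₂ ⟩
  record IsElementary : Set (o ⊔ h ⊔ c ⊔ ℓ₁ ⊔ ℓ₂) where
    field
      δ : (A : Obj) → P.Carrier (A ⊗ A)
      adjunction : ∀ (X A : Obj) (α : P.Carrier (X ⊗ A)) (β : P.Carrier ((X ⊗ A) ⊗ A)) →
        (P._≤_ ((X ⊗ A) ⊗ A)
           (P._∧_ ((X ⊗ A) ⊗ A) (P₁ π₁ α) (P₁ ⟨ π₂ ∘ π₁ , π₂ ⟩ (δ A)))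
           β)
        ⇔ P._≤_ (X ⊗ A) α (P₁ ⟨ id , π₂ ⟩ β)

  record IsVariational : Set (suc (o ⊔ h ⊔ c ⊔ ℓ₁ ⊔ ℓ₂)) where
    field
      elementary : IsElementary
    open IsElementary elementary public
    field
      comprehensive-diagonals : ∀ {X A} (f g : Hom X A) →
        (f ≡ g) ⇔ P._≈_ X (P.⊤ X) (P₁ ⟨ f , g ⟩ (δ A))
      full-weak-comprehension : ∀ {A} (α : P.Carrier A) →
        Σ Obj λ X → Σ (Hom X A) λ cα →
          P._≈_ X (P.⊤ X) (P₁ cα α)
          × (∀ {Y} (f : Hom Y A) → P._≤_ Y (P.⊤ Y) (P₁ f α) →
               Σ (Hom Y X) λ k → cα ∘ k ≡ f)
          × (∀ (β : P.Carrier A) → P._≤_ A α β ⇔ P._≤_ X (P.⊤ X) (P₁ cα β))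

{-# OPTIONS --safe #-}
module Submission where

-- A variational doctrine has enough generalised elements: by full weak comprehension,
-- α ≤ β as soon as every arrow k with ⊤ = P_k α also has ⊤ = P_k β, and by comprehensive
-- diagonals a pair ⟨f , g⟩ satisfies δ_A exactly when f = g. Hence ⟨f , g⟩ satisfies
-- P_{m×m}(δ_A) iff m f = m g, while it satisfies δ_X iff f = g; the two predicates on X × X
-- therefore coincide exactly when m is left cancellable.

open import Defs
open import Function using (_⇔_; mk⇔; Equivalence)
open import Function.Construct.Composition using (_⇔-∘_)
open import Function.Construct.Symmetry using (⇔-sym)
open import Relation.Binary.PropositionalEquality as ≡ using (_≡_; refl; cong; cong₂)
open import Data.Product using (_,_)

module Products {o h} (C : CartesianCategory o h) where
  open CartesianCategory C

  ⟨⟩-η : ∀ {Z A B} (k : Hom Z (A ⊗ B)) → k ≡ ⟨ π₁ ∘ k , π₂ ∘ k ⟩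
  ⟨⟩-η k = ⟨⟩-unique k refl refl

  ⟨⟩∘ : ∀ {Z W A B} (a : Hom W A) (b : Hom W B) (k : Hom Z W) →
        ⟨ a , b ⟩ ∘ k ≡ ⟨ a ∘ k , b ∘ k ⟩
  ⟨⟩∘ a b k = ⟨⟩-unique _ (≡.trans (≡.sym assoc) (cong (_∘ k) π₁-β))
                          (≡.trans (≡.sym assoc) (cong (_∘ k) π₂-β))

  ×₁∘⟨⟩ : ∀ {Z X Y A B} (f : Hom X A) (g : Hom Y B) (u : Hom Z X) (v : Hom Z Y) →
          (f ×₁ g) ∘ ⟨ u , v ⟩ ≡ ⟨ f ∘ u , g ∘ v ⟩
  ×₁∘⟨⟩ f g u v = begin
    ⟨ f ∘ π₁ , g ∘ π₂ ⟩ ∘ ⟨ u , v ⟩                       ≡⟨ ⟨⟩∘ (f ∘ π₁) (g ∘ π₂) ⟨ u , v ⟩ ⟩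
    ⟨ (f ∘ π₁) ∘ ⟨ u , v ⟩ , (g ∘ π₂) ∘ ⟨ u , v ⟩ ⟩       ≡⟨ cong₂ ⟨_,_⟩ (≡.trans assoc (cong (f ∘_) π₁-β))
                                                                       (≡.trans assoc (cong (g ∘_) π₂-β)) ⟩
    ⟨ f ∘ u , g ∘ v ⟩                                     ∎
    where open ≡.≡-Reasoning

module Doctrine {o h c ℓ₁ ℓ₂} {C : CartesianCategory o h} (D : PrimaryDoctrine C c ℓ₁ ℓ₂) where
  open CartesianCategory C
  open PrimaryDoctrine D

  Holds : ∀ {Z A} → Hom Z A → P.Carrier A → Set ℓ₁
  Holds {Z} k α = P._≈_ Z (P.⊤ Z) (P₁ k α)

  Holds-resp-≈ : ∀ {Z A} (k : Hom Z A) {α β : P.Carrier A} →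
                 P._≈_ A α β → Holds k α → Holds k β
  Holds-resp-≈ {Z} k α≈β holds = P.Eq.trans Z holds (P₁-cong k α≈β)

  Holds-cong : ∀ {Z A} {k l : Hom Z A} (α : P.Carrier A) → k ≡ l → Holds k α ⇔ Holds l α
  Holds-cong α refl = mk⇔ (λ holds → holds) (λ holds → holds)

  Holds-P₁ : ∀ {Z A B} (k : Hom Z A) (l : Hom A B) (α : P.Carrier B) →
             Holds k (P₁ l α) ⇔ Holds (l ∘ k) α
  Holds-P₁ {Z} k l α = mk⇔ (λ holds → P.Eq.trans Z holds (P.Eq.sym Z (P-∘ k l α)))
                           (λ holds → P.Eq.trans Z holds (P-∘ k l α))

module Variational {o h c ℓ₁ ℓ₂} {C : CartesianCategory o h} {D : PrimaryDoctrine C c ℓ₁ ℓ₂}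
    (V : IsVariational D) where
  open CartesianCategory C
  open PrimaryDoctrine D
  open IsVariational V
  open Products C
  open Doctrine D
  open Equivalence using (to; from)

  ≤-fromHolds : ∀ {A} {α β : P.Carrier A} →
                (∀ {Z} (k : Hom Z A) → Holds k α → Holds k β) → P._≤_ A α β
  ≤-fromHolds {α = α} {β} holds with full-weak-comprehension α
  ... | X , cα , ⊤≈cα , _ , ≤⇔ = from (≤⇔ β) (P.reflexive X (holds cα ⊤≈cα))

  ≈-fromHoldsOnPairs : ∀ {A B} {α β : P.Carrier (A ⊗ B)} →
                       (∀ {Z} (f : Hom Z A) (g : Hom Z B) → Holds ⟨ f , g ⟩ α ⇔ Holds ⟨ f , g ⟩ β) →
                       P._≈_ (A ⊗ B) α β
  ≈-fromHoldsOnPairs {A} {B} {α} {β} holds = 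
    P.antisym (A ⊗ B) (≤-fromHolds λ k → to (pairs k)) (≤-fromHolds λ k → from (pairs k))
    where
    pairs : ∀ {Z} (k : Hom Z (A ⊗ B)) → Holds k α ⇔ Holds k β
    pairs k = Holds-cong β (≡.sym (⟨⟩-η k)) ⇔-∘ (holds (π₁ ∘ k) (π₂ ∘ k) ⇔-∘ Holds-cong α (⟨⟩-η k))

  Holds-δ⇔≡ : ∀ {Z A} (f g : Hom Z A) → Holds ⟨ f , g ⟩ (δ A) ⇔ f ≡ g
  Holds-δ⇔≡ f g = ⇔-sym (comprehensive-diagonals f g)

  Holds-×₁δ⇔≡ : ∀ {Z X A} (m : Hom X A) (f g : Hom Z X) →
                Holds ⟨ f , g ⟩ (P₁ (m ×₁ m) (δ A)) ⇔ m ∘ f ≡ m ∘ g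
  Holds-×₁δ⇔≡ {A = A} m f g =
    Holds-δ⇔≡ (m ∘ f) (m ∘ g) ⇔-∘ (Holds-cong (δ A) (×₁∘⟨⟩ m m f g) ⇔-∘ Holds-P₁ ⟨ f , g ⟩ (m ×₁ m) (δ A))

  mono⇔injective : ∀ {X A} (m : Hom X A) → IsMono m ⇔ P._≈_ (X ⊗ X) (P₁ (m ×₁ m) (δ A)) (δ X)
  mono⇔injective {X} {A} m = mk⇔ injective mono
    where
    injective : IsMono m → P._≈_ (X ⊗ X) (P₁ (m ×₁ m) (δ A)) (δ X)
    injective isMono = ≈-fromHoldsOnPairs λ f g →
      ⇔-sym (Holds-δ⇔≡ f g) ⇔-∘ (mk⇔ (isMono f g) (cong (m ∘_)) ⇔-∘ Holds-×₁δ⇔≡ m f g)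
    mono : P._≈_ (X ⊗ X) (P₁ (m ×₁ m) (δ A)) (δ X) → IsMono m
    mono P×δ≈δ f g mf≡mg =
      to (Holds-δ⇔≡ f g) (Holds-resp-≈ ⟨ f , g ⟩ P×δ≈δ (from (Holds-×₁δ⇔≡ m f g) mf≡mg))

proposition4p8 : ∀ {o h c ℓ₁ ℓ₂} (C : CartesianCategory o h) (D : PrimaryDoctrine C c ℓ₁ ℓ₂)
                 (V : IsVariational D) →
                 ∀ {X A} (m : CartesianCategory.Hom C X A) →
                 CartesianCategory.IsMono C m
                 ⇔ PrimaryDoctrine.P._≈_ D (CartesianCategory._⊗_ C X X)
                     (PrimaryDoctrine.P₁ D (CartesianCategory._×₁_ C m m) (IsVariational.δ V A))
                     (IsVariational.δ V X)
proposition4p8 C D V = Variational.mono⇔injective V
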